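{- Let $G \subseteq \mathrm{GL}_2(\widehat{\mathbb{Z}})$ be an open (in particular closed) subgroup. Let $m_1, m_2$ be coprime positive integers such that whenever $d_1,d_2$ are positive integers with $d_i \mid m_i$ for $i \in \{1,2\}$ and $(d_1,d_2) \ne (m_1,m_2)$, one has $\widehat{G(d_1d_2)} \supsetneq \widehat{G(m_1m_2)}$. Then $m_1m_2$ divides the level of $G$.
   Context: For $H \subseteq \mathrm{GL}_2(\widehat{\mathbb{Z}})$, $H(n)$ is the image in $\mathrm{GL}_2(\mathbb{Z}/n\mathbb{Z})$, and for a subgroup $K \subseteq \mathrm{GL}_2(\mathbb{Z}/n\mathbb{Z})$, $\widehat{K}$ is its full preimage in $\mathrm{GL}_2(\widehat{\mathbb{Z}})$. The level of an open subgroup $G$ is the least positive integer $m$ with $G = \widehat{G(m)}$. -}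

module Defs where

open import Data.Nat using (ℕ; zero; suc; _+_; _*_; _%_; _<_; _∸_; pred)
open import Data.Nat.Divisibility using (_∣_)
open import Data.Product using (Σ; _×_; ∃)
open import Relation.Binary.PropositionalEquality using (_≡_)
open import Relation.Nullary using (¬_)

-- Raw profinite integers: x k is the residue modulo (suc k).
ℤ̂raw : Set
ℤ̂raw = ℕ → ℕ

ValidẐ : ℤ̂raw → Set
ValidẐ x = (∀ k → x k < suc k)
         × (∀ k d → suc d ∣ suc k → x k % suc d ≡ x d)

infixl 6 _+̂_
infixl 7 _*̂_

_+̂_ : ℤ̂raw → ℤ̂raw → ℤ̂raw
(x +̂ y) k = (x k + y k) % suc k

_*̂_ : ℤ̂raw → ℤ̂raw → ℤ̂raw
(x *̂ y) k = (x k * y k) % suc k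

0̂ 1̂ : ℤ̂raw
0̂ k = 0
1̂ k = 1 % suc k

record Mat : Set where
  constructor mat
  field
    a b c d : ℤ̂raw
open Mat public

_·_ : Mat → Mat → Mat
A · B = mat (a A *̂ a B +̂ b A *̂ c B) (a A *̂ b B +̂ b A *̂ d B)
            (c A *̂ a B +̂ d A *̂ c B) (c A *̂ b B +̂ d A *̂ d B)

I₂ : Mat
I₂ = mat 1̂ 0̂ 0̂ 1̂

_≡[mod-suc_]_ : Mat → ℕ → Mat → Set
A ≡[mod-suc k ] B = (a A k ≡ a B k) × (b A k ≡ b B k) × (c A k ≡ c B k) × (d A k ≡ d B k)

_≈_ : Mat → Mat → Set
A ≈ B = ∀ k → A ≡[mod-suc k ] B

ValidMat : Mat → Set
ValidMat A = ValidẐ (a A) × ValidẐ (b A) × ValidẐ (c A) × ValidẐ (d A)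

IsGL₂ : Mat → Set
IsGL₂ A = ValidMat A × Σ Mat (λ B → ValidMat B × (A · B) ≈ I₂ × (B · A) ≈ I₂)

record IsOpenSubgroup (G : Mat → Set) : Set where
  field
    ⊆GL₂   : ∀ A → G A → IsGL₂ A
    resp   : ∀ A B → IsGL₂ B → A ≈ B → G A → G B
    one    : G I₂
    mul    : ∀ A B → G A → G B → G (A · B)
    inv    : ∀ A B → G A → IsGL₂ B → (A · B) ≈ I₂ → G B
    open′  : Σ ℕ (λ N → ∀ A → IsGL₂ A → A ≡[mod-suc N ] I₂ → G A)

-- Ĝ(n) = full preimage of G(n) in GL₂(ℤ̂), for n ≥ 1 (level index pred n).
Ĝ : (Mat → Set) → ℕ → Mat → Set
Ĝ G n A = IsGL₂ A × Σ Mat (λ B → G B × B ≡[mod-suc pred n ] A)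

_⊆_ : (Mat → Set) → (Mat → Set) → Set
P ⊆ Q = ∀ A → P A → Q A

_⊋_ : (Mat → Set) → (Mat → Set) → Set
P ⊋ Q = (Q ⊆ P) × ¬ (P ⊆ Q)

-- m is the level of G: least positive m with G = Ĝ(m)
-- (G ⊆ Ĝ(n) always holds for G ⊆ GL₂(ℤ̂)).
IsLevel : (Mat → Set) → ℕ → Set
IsLevel G m = (0 < m) × (Ĝ G m ⊆ G) × (∀ n → 0 < n → n < m → ¬ (Ĝ G n ⊆ G))

-- Let L be the level of G and dᵢ = gcd(L, mᵢ); then L = d s and m₁m₂ = d t with d = d₁d₂ and
-- t ⊥ s. If m₁m₂ ∤ L then (d₁, d₂) ≠ (m₁, m₂), so Ĝ(d) ⊈ Ĝ(m₁m₂) by hypothesis. But let ε ∈ ℤ̂ be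
-- the idempotent that is 1 at the primes dividing t and 0 at all others, and ε′ = 1 − ε. For
-- A ∈ Ĝ(d), pick B ∈ G with B ≡ A mod d and put C = εA + ε′B. Then C ∈ GL₂(ℤ̂), since
-- X, Y ↦ εX + ε′Y is multiplicative; C ≡ B mod L, so C ∈ Ĝ(L) = G; and C ≡ A mod m₁m₂, so
-- A ∈ Ĝ(m₁m₂). As ℤ̂ is encoded by compatible residues, ε is built level by level: each level
-- splits as (t-part) · (t-free part), and ε is the Chinese-remainder idempotent of that splitting.

module Submission where

open import Defs
open import Data.Nat using (ℕ; zero; suc; _+_; _*_; _∸_; _^_; _<_; _≤_; NonZero; pred; _%_; _/_; ≢-nonZero; ≢-nonZero⁻¹; >-nonZero; >-nonZero⁻¹)
open import Data.Nat.Properties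
open import Data.Nat.Divisibility using (_∣_; divides; _∣?_; ∣-trans; ∣-refl; *-pres-∣; ∣1⇒≡1; m∣m*n; n∣m*n; ∣m+n∣m⇒∣n)
open import Data.Nat.DivMod using (m%n<n; m≡m%n+[m/n]*n; [m+kn]%n≡m%n; m<n⇒m%n≡m; m*[n/m]≡n; m%n%n≡m%n)
open import Data.Nat.GCD using (gcd; gcd[m,n]∣m; gcd[m,n]∣n; gcd[m,n]≢0; module Bézout)
open import Data.Nat.LCM using (lcm; lcm-least; gcd*lcm)
open import Data.Nat.Coprimality using (Coprime)
import Data.Nat.Coprimality as Coprimality
open import Data.Nat.Induction using (<-wellFounded)
open import Induction.WellFounded using (Acc; acc)
open import Data.Nat.Tactic.RingSolver using (solve-∀)
open import Algebra.Properties.CommutativeSemigroup *-commutativeSemigroup using (interchange; xy∙z≈y∙xz)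
open import Data.Product using (∃; ∃₂; _×_; _,_; proj₁; proj₂)
open import Data.Sum using (inj₁; inj₂)
open import Data.Empty using (⊥-elim)
open import Relation.Binary.Bundles using (Setoid)
import Relation.Binary.Reasoning.Setoid as SetoidReasoning
open import Relation.Binary.PropositionalEquality using (_≡_; refl; sym; trans; cong; cong₂; subst; module ≡-Reasoning)
open import Relation.Nullary using (¬_; yes; no)
open import Function using (_$_)

private variable
  k l m n o p q : ℕ
  u v : ℤ̂raw

-- Congruences

-- Stated without subtraction, which is truncated on ℕ.
infix 4 _≡_mod_
record _≡_mod_ (m n o : ℕ) : Set where
  constructor congruent
  field
    i j : ℕ
    witness : m + i * o ≡ n + j * o

≡-mod-refl : m ≡ m mod o
≡-mod-refl = congruent 0 0 refl

≡⇒≡-mod : m ≡ n → m ≡ n mod o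
≡⇒≡-mod refl = ≡-mod-refl

≡-mod-sym : m ≡ n mod o → n ≡ m mod o
≡-mod-sym (congruent i j eq) = congruent j i (sym eq)

≡-mod-trans : m ≡ n mod o → n ≡ p mod o → m ≡ p mod o
≡-mod-trans {m} {n} {o} {p} (congruent i j m≡n) (congruent i′ j′ n≡p) = congruent (i + i′) (j + j′) (begin
  m + (i + i′) * o         ≡⟨ shift m i i′ o ⟩
  (m + i * o) + i′ * o     ≡⟨ cong (_+ i′ * o) m≡n ⟩
  (n + j * o) + i′ * o     ≡⟨ swap n j i′ o ⟩
  (n + i′ * o) + j * o     ≡⟨ cong (_+ j * o) n≡p ⟩
  (p + j′ * o) + j * o     ≡⟨ swap p j′ j o ⟩
  (p + j * o) + j′ * o     ≡⟨ shift p j j′ o ⟨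
  p + (j + j′) * o         ∎)
  where
  open ≡-Reasoning
  shift : ∀ x i i′ o → x + (i + i′) * o ≡ (x + i * o) + i′ * o
  shift = solve-∀
  swap : ∀ x i i′ o → (x + i * o) + i′ * o ≡ (x + i′ * o) + i * o
  swap = solve-∀

≡-mod-setoid : ℕ → Setoid _ _
≡-mod-setoid o = record
  { Carrier = ℕ
  ; _≈_ = λ m n → m ≡ n mod o
  ; isEquivalence = record { refl = ≡-mod-refl ; sym = ≡-mod-sym ; trans = ≡-mod-trans }
  }

module ≡-mod-Reasoning (o : ℕ) = SetoidReasoning (≡-mod-setoid o)

≡-mod-+ : m ≡ n mod o → p ≡ q mod o → m + p ≡ n + q mod o
≡-mod-+ {m} {n} {o} {p} {q} (congruent i j m≡n) (congruent i′ j′ p≡q) = congruent (i + i′) (j + j′) (begin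
  m + p + (i + i′) * o         ≡⟨ regroup m p i i′ o ⟩
  (m + i * o) + (p + i′ * o)   ≡⟨ cong₂ _+_ m≡n p≡q ⟩
  (n + j * o) + (q + j′ * o)   ≡⟨ regroup n q j j′ o ⟨
  n + q + (j + j′) * o         ∎)
  where
  open ≡-Reasoning
  regroup : ∀ m p i i′ o → m + p + (i + i′) * o ≡ (m + i * o) + (p + i′ * o)
  regroup = solve-∀

≡-mod-* : m ≡ n mod o → p ≡ q mod o → m * p ≡ n * q mod o
≡-mod-* {m} {n} {o} {p} {q} (congruent i j m≡n) (congruent i′ j′ p≡q) =
  congruent (i * p + m * i′ + i * i′ * o) (j * q + n * j′ + j * j′ * o) (begin
    m * p + (i * p + m * i′ + i * i′ * o) * o   ≡⟨ expand m p i i′ o ⟩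
    (m + i * o) * (p + i′ * o)                 ≡⟨ cong₂ _*_ m≡n p≡q ⟩
    (n + j * o) * (q + j′ * o)                 ≡⟨ expand n q j j′ o ⟨
    n * q + (j * q + n * j′ + j * j′ * o) * o   ∎)
  where
  open ≡-Reasoning
  expand : ∀ m p i i′ o → m * p + (i * p + m * i′ + i * i′ * o) * o ≡ (m + i * o) * (p + i′ * o)
  expand = solve-∀

≡-mod-∣ : o ∣ p → m ≡ n mod p → m ≡ n mod o
≡-mod-∣ {o} {m = m} {n} (divides k refl) (congruent i j eq) = congruent (i * k) (j * k) $
  trans (cong (m +_) (*-assoc i k o)) (trans eq (cong (n +_) (sym (*-assoc j k o))))

%-≡-mod : ∀ m o .{{_ : NonZero o}} → m % o ≡ m mod o
%-≡-mod m o = congruent (m / o) 0 $ trans (sym (m≡m%n+[m/n]*n m o)) (sym (+-identityʳ m))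

≡-mod⇒%≡ : .{{_ : NonZero o}} → m ≡ n mod o → m % o ≡ n % o
≡-mod⇒%≡ {o} {m} {n} (congruent i j eq) =
  trans (sym ([m+kn]%n≡m%n m i o)) (trans (cong (_% o) eq) ([m+kn]%n≡m%n n j o))

≡-mod⇒≡ : .{{_ : NonZero o}} → m < o → n < o → m ≡ n mod o → m ≡ n
≡-mod⇒≡ m<o n<o m≡n = trans (sym (m<n⇒m%n≡m m<o)) (trans (≡-mod⇒%≡ m≡n) (m<n⇒m%n≡m n<o))

∣⇒≡-mod-0 : o ∣ m → m ≡ 0 mod o
∣⇒≡-mod-0 {o} (divides k refl) = congruent 0 k (+-identityʳ (k * o))

≡-mod⇒∣∸ : m ≤ n → m ≡ n mod o → o ∣ n ∸ m
≡-mod⇒∣∸ {m} {n} {o} m≤n (congruent i j eq) = ∣m+n∣m⇒∣n (subst (o ∣_) (+-cancelˡ-≡ m _ _ i*o≡) (n∣m*n i)) (n∣m*n j)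
  where
  i*o≡ : m + i * o ≡ m + (j * o + (n ∸ m))
  i*o≡ = trans eq (trans (cong (_+ j * o) (sym (m+[n∸m]≡n m≤n)))
                  (trans (+-assoc m (n ∸ m) (j * o)) (cong (m +_) (+-comm (n ∸ m) (j * o)))))

∣∸⇒≡-mod : m ≤ n → o ∣ n ∸ m → m ≡ n mod o
∣∸⇒≡-mod {m} {n} m≤n (divides k n∸m≡k*o) =
  congruent k 0 $ trans (cong (m +_) (sym n∸m≡k*o)) (trans (m+[n∸m]≡n m≤n) (sym (+-identityʳ n)))

coprime⇒*-∣ : Coprime m n → m ∣ o → n ∣ o → m * n ∣ o
coprime⇒*-∣ {m} {n} m⊥n m∣o n∣o = subst (_∣ _) lcm≡m*n (lcm-least m∣o n∣o)
  where
  lcm≡m*n : lcm m n ≡ m * n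
  lcm≡m*n = trans (sym (*-identityˡ (lcm m n)))
              (trans (cong (_* lcm m n) (sym (Coprimality.coprime⇒gcd≡1 m⊥n))) (gcd*lcm m n))

≡-mod-CRT : Coprime o p → m ≡ n mod o → m ≡ n mod p → m ≡ n mod o * p
≡-mod-CRT {m = m} {n} o⊥p m≡n₁ m≡n₂ with ≤-total m n
... | inj₁ m≤n = ∣∸⇒≡-mod m≤n (coprime⇒*-∣ o⊥p (≡-mod⇒∣∸ m≤n m≡n₁) (≡-mod⇒∣∸ m≤n m≡n₂))
... | inj₂ n≤m = ≡-mod-sym (∣∸⇒≡-mod n≤m
        (coprime⇒*-∣ o⊥p (≡-mod⇒∣∸ n≤m (≡-mod-sym m≡n₁)) (≡-mod⇒∣∸ n≤m (≡-mod-sym m≡n₂))))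

coprime-∣ʳ : Coprime m n → o ∣ n → Coprime m o
coprime-∣ʳ m⊥n o∣n (i∣m , i∣o) = m⊥n (i∣m , ∣-trans i∣o o∣n)

coprime-*ʳ : Coprime m n → Coprime m o → Coprime m (n * o)
coprime-*ʳ m⊥n m⊥o (i∣m , i∣n*o) =
  m⊥o (i∣m , Coprimality.coprime-divisor (λ (j∣i , j∣n) → m⊥n (∣-trans j∣i i∣m , j∣n)) i∣n*o)

coprime-^ʳ : Coprime m n → ∀ k → Coprime m (n ^ k)
coprime-^ʳ m⊥n zero    (_ , i∣1) = ∣1⇒≡1 i∣1
coprime-^ʳ m⊥n (suc k) = coprime-*ʳ m⊥n (coprime-^ʳ m⊥n k)

coprime-∣ˡ : Coprime m n → o ∣ m → Coprime o n
coprime-∣ˡ m⊥n o∣m = Coprimality.sym (coprime-∣ʳ (Coprimality.sym m⊥n) o∣m)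

*≡⇒nonZeroʳ : ∀ m .{{_ : NonZero n}} → m * o ≡ n → NonZero o
*≡⇒nonZeroʳ {n} m m*o≡n =
  ≢-nonZero λ o≡0 → ≢-nonZero⁻¹ n (trans (sym m*o≡n) (trans (cong (m *_) o≡0) (*-zeroʳ m)))

gcd-nonZeroʳ : ∀ m n .{{_ : NonZero n}} → NonZero (gcd m n)
gcd-nonZeroʳ m n = ≢-nonZero (gcd[m,n]≢0 m n (inj₂ (≢-nonZero⁻¹ n)))

-- Idempotents modulo n

coprime⇒idempotent : Coprime m n → ∃ λ e → e ≡ 1 mod m × e ≡ 0 mod n
coprime⇒idempotent {m} {n} m⊥n = from-Bézout n (Coprimality.coprime-Bézout m⊥n)
  where
  from-Bézout : ∀ n → Bézout.Identity 1 m n → ∃ λ e → e ≡ 1 mod m × e ≡ 0 mod n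
  from-Bézout n (Bézout.-+ x y 1+xm≡yn) =
    y * n , congruent 0 x (trans (+-identityʳ (y * n)) (sym 1+xm≡yn)) , ∣⇒≡-mod-0 (n∣m*n y)
  from-Bézout zero (Bézout.+- x y 1+y0≡xm) =
    0 , congruent x 0 (trans (sym 1+y0≡xm) (cong (1 +_) (*-zeroʳ y))) , ≡-mod-refl
  from-Bézout (suc n) (Bézout.+- x y 1+yn≡xm) = 1 + n * (x * m) , ≡1 , ≡0
    where
    -- x m is ≡ 0 mod m and ≡ 1 mod (suc n); scaling it by n and adding 1 turns the latter into 0.
    ≡1 : 1 + n * (x * m) ≡ 1 mod m
    ≡1 = begin
      1 + n * (x * m)   ≈⟨ ≡-mod-+ (≡-mod-refl {1}) (≡-mod-* (≡-mod-refl {n}) (∣⇒≡-mod-0 (n∣m*n x))) ⟩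
      1 + n * 0         ≡⟨ cong (1 +_) (*-zeroʳ n) ⟩
      1                 ∎
      where open ≡-mod-Reasoning m
    ≡0 : 1 + n * (x * m) ≡ 0 mod suc n
    ≡0 = begin
      1 + n * (x * m)   ≈⟨ ≡-mod-+ (≡-mod-refl {1}) (≡-mod-* (≡-mod-refl {n}) xm≡1) ⟩
      1 + n * 1         ≡⟨ cong (1 +_) (*-identityʳ n) ⟩
      suc n             ≈⟨ ∣⇒≡-mod-0 ∣-refl ⟩
      0                 ∎
      where
      open ≡-mod-Reasoning (suc n)
      xm≡1 : x * m ≡ 1 mod suc n
      xm≡1 = congruent 0 y (trans (+-identityʳ (x * m)) (sym 1+yn≡xm))

module Blend {o e e′ : ℕ} (e+e′≡1 : e + e′ ≡ 1 mod o) (e*e′≡0 : e * e′ ≡ 0 mod o) where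
  open ≡-mod-Reasoning o

  blend : ℕ → ℕ → ℕ
  blend m n = e * m + e′ * n

  e*e≡e : e * e ≡ e mod o
  e*e≡e = begin
    e * e            ≡⟨ +-identityʳ (e * e) ⟨
    e * e + 0        ≈⟨ ≡-mod-+ ≡-mod-refl e*e′≡0 ⟨
    e * e + e * e′   ≡⟨ *-distribˡ-+ e e e′ ⟨
    e * (e + e′)     ≈⟨ ≡-mod-* (≡-mod-refl {e}) e+e′≡1 ⟩
    e * 1            ≡⟨ *-identityʳ e ⟩
    e                ∎

  e′*e′≡e′ : e′ * e′ ≡ e′ mod o
  e′*e′≡e′ = begin
    e′ * e′           ≈⟨ ≡-mod-+ e*e′≡0 ≡-mod-refl ⟨
    e * e′ + e′ * e′  ≡⟨ *-distribʳ-+ e′ e e′ ⟨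
    (e + e′) * e′     ≈⟨ ≡-mod-* e+e′≡1 ≡-mod-refl ⟩
    1 * e′            ≡⟨ *-identityˡ e′ ⟩
    e′                ∎

  blend-cong : m ≡ n mod o → p ≡ q mod o → blend m p ≡ blend n q mod o
  blend-cong m≡n p≡q = ≡-mod-+ (≡-mod-* (≡-mod-refl {e}) m≡n) (≡-mod-* (≡-mod-refl {e′}) p≡q)

  blend-+ : ∀ m n p q → blend m n + blend p q ≡ blend (m + p) (n + q)
  blend-+ m n p q = distrib e e′ m n p q
    where
    distrib : ∀ e e′ m n p q → (e * m + e′ * n) + (e * p + e′ * q) ≡ e * (m + p) + e′ * (n + q)
    distrib = solve-∀

  blend-* : ∀ m n p q → blend m n * blend p q ≡ blend (m * p) (n * q) mod o
  blend-* m n p q = begin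
    blend m n * blend p q
      ≡⟨ expand e e′ m n p q ⟩
    e * e * (m * p) + e′ * e′ * (n * q) + e * e′ * (m * q + n * p)
      ≈⟨ ≡-mod-+ (≡-mod-+ (≡-mod-* e*e≡e ≡-mod-refl) (≡-mod-* e′*e′≡e′ ≡-mod-refl)) (≡-mod-* e*e′≡0 ≡-mod-refl) ⟩
    e * (m * p) + e′ * (n * q) + 0
      ≡⟨ +-identityʳ _ ⟩
    blend (m * p) (n * q) ∎
    where
    expand : ∀ e e′ m n p q → (e * m + e′ * n) * (e * p + e′ * q)
           ≡ e * e * (m * p) + e′ * e′ * (n * q) + e * e′ * (m * q + n * p)
    expand = solve-∀

  blend-diag : ∀ m → blend m m ≡ m mod o
  blend-diag m = begin
    e * m + e′ * m   ≡⟨ *-distribʳ-+ m e e′ ⟨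
    (e + e′) * m     ≈⟨ ≡-mod-* e+e′≡1 ≡-mod-refl ⟩
    1 * m            ≡⟨ *-identityˡ m ⟩
    m                ∎

-- Splitting off the t-part

record Split (t n : ℕ) : Set where
  field
    part cofactor exponent : ℕ
    factorisation : n ≡ part * cofactor
    part∣t^exponent : part ∣ t ^ exponent
    cofactor⊥t : Coprime cofactor t

  part∣ : part ∣ n
  part∣ = divides cofactor (trans factorisation (*-comm part cofactor))

  cofactor∣ : cofactor ∣ n
  cofactor∣ = divides part factorisation

open Split

cofactor⊥part : ∀ {t} (D : Split t n) (E : Split t m) → Coprime (cofactor D) (part E)
cofactor⊥part D E = coprime-∣ʳ (coprime-^ʳ (cofactor⊥t D) (exponent E)) (part∣t^exponent E)

split-∣ : ∀ {t} → m ∣ n → (D : Split t n) (E : Split t m) → part E ∣ part D × cofactor E ∣ cofactor D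
split-∣ {m} {n} m∣n D E =
    Coprimality.coprime-divisor (Coprimality.sym (cofactor⊥part D E))
      (subst (part E ∣_) (trans (factorisation D) (*-comm (part D) (cofactor D))) (∣-trans (part∣ E) m∣n))
  , Coprimality.coprime-divisor (cofactor⊥part E D)
      (subst (cofactor E ∣_) (factorisation D) (∣-trans (cofactor∣ E) m∣n))

split-*ˡ : ∀ {t} → o ∣ t → Split t n → Split t (o * n)
split-*ˡ {o} {n} o∣t D = record
  { part = o * part D ; cofactor = cofactor D ; exponent = suc (exponent D)
  ; factorisation = trans (cong (o *_) (factorisation D)) (sym (*-assoc o (part D) (cofactor D)))
  ; part∣t^exponent = *-pres-∣ o∣t (part∣t^exponent D)
  ; cofactor⊥t = cofactor⊥t D
  }

split-acc : ∀ t n .{{_ : NonZero n}} → Acc _<_ n → Split t n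
split-acc t n (acc smaller) with Coprimality.coprime? n t
... | yes n⊥t = record
  { part = 1 ; cofactor = n ; exponent = 0 ; factorisation = sym (*-identityˡ n)
  ; part∣t^exponent = ∣-refl ; cofactor⊥t = n⊥t }
... | no ¬n⊥t = subst (Split t) g*n/g≡n (split-*ˡ (gcd[m,n]∣n n t) (split-acc t n/g {{n/g≢0}} (smaller n/g<n)))
  where
  g : ℕ
  g = gcd n t
  instance
    g≢0 : NonZero g
    g≢0 = ≢-nonZero (gcd[m,n]≢0 n t (inj₁ (≢-nonZero⁻¹ n)))
  n/g : ℕ
  n/g = n / g
  g*n/g≡n : g * n/g ≡ n
  g*n/g≡n = m*[n/m]≡n (gcd[m,n]∣m n t)
  n/g≢0 : NonZero n/g
  n/g≢0 = *≡⇒nonZeroʳ g g*n/g≡n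
  1<g : 1 < g
  1<g = ≤∧≢⇒< (>-nonZero⁻¹ g) (λ 1≡g → ¬n⊥t (Coprimality.gcd≡1⇒coprime (sym 1≡g)))
  n/g<n : n/g < n
  n/g<n = subst (n/g <_) (trans (*-comm n/g g) g*n/g≡n) (m<m*n n/g g {{n/g≢0}} 1<g)

split : ∀ t n .{{_ : NonZero n}} → Split t n
split t n = split-acc t n (<-wellFounded n)

-- Profinite integers and matrices

reduce-valid : (r : ℕ → ℕ) → (∀ k l → suc l ∣ suc k → r k ≡ r l mod suc l) → ValidẐ (λ k → r k % suc k)
reduce-valid r compatible = (λ k → m%n<n (r k) (suc k)) , λ k l l∣k →
  ≡-mod⇒%≡ (≡-mod-trans (≡-mod-∣ l∣k (%-≡-mod (r k) (suc k))) (compatible k l l∣k))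

valid-compatible : ValidẐ u → suc l ∣ suc k → u k ≡ u l mod suc l
valid-compatible {u} {l} {k} (_ , compatible) l∣k =
  ≡-mod-trans (≡-mod-sym (%-≡-mod (u k) (suc l))) (≡⇒≡-mod (compatible k l l∣k))

valid-+̂ : ValidẐ u → ValidẐ v → ValidẐ (u +̂ v)
valid-+̂ {u} {v} valid-u valid-v = reduce-valid (λ k → u k + v k) λ _ _ l∣k →
  ≡-mod-+ (valid-compatible valid-u l∣k) (valid-compatible valid-v l∣k)

valid-*̂ : ValidẐ u → ValidẐ v → ValidẐ (u *̂ v)
valid-*̂ {u} {v} valid-u valid-v = reduce-valid (λ k → u k * v k) λ _ _ l∣k →
  ≡-mod-* (valid-compatible valid-u l∣k) (valid-compatible valid-v l∣k)

≈-trans : ∀ {A B C} → A ≈ B → B ≈ C → A ≈ C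
≈-trans A≈B B≈C k with A≈B k | B≈C k
... | a₁ , b₁ , c₁ , d₁ | a₂ , b₂ , c₂ , d₂ = trans a₁ a₂ , trans b₁ b₂ , trans c₁ c₂ , trans d₁ d₂

Entrywise : (ℤ̂raw → ℤ̂raw → Set) → Mat → Mat → Set
Entrywise R A B = R (a A) (a B) × R (b A) (b B) × R (c A) (c B) × R (d A) (d B)

entrywise : {R S : ℤ̂raw → ℤ̂raw → Set} → (∀ {u v} → ValidẐ u → ValidẐ v → R u v → S u v)
          → ∀ {A B} → ValidMat A → ValidMat B → Entrywise R A B → Entrywise S A B
entrywise f (a₁ , b₁ , c₁ , d₁) (a₂ , b₂ , c₂ , d₂) (ra , rb , rc , rd) =
  f a₁ a₂ ra , f b₁ b₂ rb , f c₁ c₂ rc , f d₁ d₂ rd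

module Idempotents (t : ℕ) where

  split-at : ∀ k → Split t (suc k)
  split-at k = split t (suc k)

  part-at cofactor-at : ℕ → ℕ
  part-at k = part (split-at k)
  cofactor-at k = cofactor (split-at k)

  part⊥cofactor-at : ∀ k → Coprime (part-at k) (cofactor-at k)
  part⊥cofactor-at k = Coprimality.sym (cofactor⊥part (split-at k) (split-at k))

  ≡-mod-CRT-at : ∀ k → m ≡ n mod part-at k → m ≡ n mod cofactor-at k → m ≡ n mod suc k
  ≡-mod-CRT-at {m} {n} k m≡n₁ m≡n₂ = subst (m ≡ n mod_) (sym (factorisation (split-at k)))
    (≡-mod-CRT (part⊥cofactor-at k) m≡n₁ m≡n₂)

  reduced-≡-mod : ∀ k r → o ∣ suc k → r % suc k ≡ r mod o
  reduced-≡-mod k r o∣k = ≡-mod-∣ o∣k (%-≡-mod r (suc k))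

  valid-from-parts : (r : ℕ → ℕ) → (∀ k → r k ≡ m mod part-at k) → (∀ k → r k ≡ n mod cofactor-at k)
                   → ValidẐ (λ k → r k % suc k)
  valid-from-parts r r≡m r≡n = reduce-valid r λ k l l∣k →
    let partₗ∣partₖ , cofactorₗ∣cofactorₖ = split-∣ l∣k (split-at k) (split-at l) in
    ≡-mod-CRT-at l (≡-mod-trans (≡-mod-∣ partₗ∣partₖ (r≡m k)) (≡-mod-sym (r≡m l)))
                   (≡-mod-trans (≡-mod-∣ cofactorₗ∣cofactorₖ (r≡n k)) (≡-mod-sym (r≡n l)))

  e₁₀ : ∀ k → ∃ λ e → e ≡ 1 mod part-at k × e ≡ 0 mod cofactor-at k
  e₁₀ k = coprime⇒idempotent (part⊥cofactor-at k)

  e₀₁ : ∀ k → ∃ λ e → e ≡ 1 mod cofactor-at k × e ≡ 0 mod part-at k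
  e₀₁ k = coprime⇒idempotent (Coprimality.sym (part⊥cofactor-at k))

  ε ε′ : ℤ̂raw
  ε k = proj₁ (e₁₀ k) % suc k
  ε′ k = proj₁ (e₀₁ k) % suc k

  valid-ε : ValidẐ ε
  valid-ε = valid-from-parts (λ k → proj₁ (e₁₀ k)) (λ k → proj₁ (proj₂ (e₁₀ k))) (λ k → proj₂ (proj₂ (e₁₀ k)))

  valid-ε′ : ValidẐ ε′
  valid-ε′ = valid-from-parts (λ k → proj₁ (e₀₁ k)) (λ k → proj₂ (proj₂ (e₀₁ k))) (λ k → proj₁ (proj₂ (e₀₁ k)))

  ε-part : ∀ k → ε k ≡ 1 mod part-at k
  ε-part k = ≡-mod-trans (reduced-≡-mod k _ (part∣ (split-at k))) (proj₁ (proj₂ (e₁₀ k)))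

  ε-cofactor : ∀ k → ε k ≡ 0 mod cofactor-at k
  ε-cofactor k = ≡-mod-trans (reduced-≡-mod k _ (cofactor∣ (split-at k))) (proj₂ (proj₂ (e₁₀ k)))

  ε′-part : ∀ k → ε′ k ≡ 0 mod part-at k
  ε′-part k = ≡-mod-trans (reduced-≡-mod k _ (part∣ (split-at k))) (proj₂ (proj₂ (e₀₁ k)))

  ε′-cofactor : ∀ k → ε′ k ≡ 1 mod cofactor-at k
  ε′-cofactor k = ≡-mod-trans (reduced-≡-mod k _ (cofactor∣ (split-at k))) (proj₁ (proj₂ (e₀₁ k)))

  ε+ε′≡1 : ∀ k → ε k + ε′ k ≡ 1 mod suc k
  ε+ε′≡1 k = ≡-mod-CRT-at k (≡-mod-+ (ε-part k) (ε′-part k)) (≡-mod-+ (ε-cofactor k) (ε′-cofactor k))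

  ε*ε′≡0 : ∀ k → ε k * ε′ k ≡ 0 mod suc k
  ε*ε′≡0 k = ≡-mod-CRT-at k (≡-mod-* (ε-part k) (ε′-part k)) (≡-mod-* (ε-cofactor k) (ε′-cofactor k))

  module Blendₖ (k : ℕ) = Blend {suc k} {ε k} {ε′ k} (ε+ε′≡1 k) (ε*ε′≡0 k)
  open Blendₖ using (blend)

  mix : ℤ̂raw → ℤ̂raw → ℤ̂raw
  mix u v = ε *̂ u +̂ ε′ *̂ v

  mix-unreduced : ∀ k m n → (ε k * m) % suc k + (ε′ k * n) % suc k ≡ blend k m n mod suc k
  mix-unreduced k m n = ≡-mod-+ (%-≡-mod (ε k * m) (suc k)) (%-≡-mod (ε′ k * n) (suc k))

  mix≡blend : ∀ u v k → mix u v k ≡ blend k (u k) (v k) mod suc k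
  mix≡blend u v k = ≡-mod-trans (%-≡-mod _ (suc k)) (mix-unreduced k (u k) (v k))

  mix-+̂ : ∀ u u′ v v′ k → mix (u +̂ u′) (v +̂ v′) k ≡ (mix u v +̂ mix u′ v′) k
  mix-+̂ u u′ v v′ k = ≡-mod⇒%≡ (begin
    _                                         ≈⟨ mix-unreduced k _ _ ⟩
    blend k ((u +̂ u′) k) ((v +̂ v′) k)          ≈⟨ Blendₖ.blend-cong k (%-≡-mod _ (suc k)) (%-≡-mod _ (suc k)) ⟩
    blend k (u k + u′ k) (v k + v′ k)         ≡⟨ Blendₖ.blend-+ k (u k) (v k) (u′ k) (v′ k) ⟨
    blend k (u k) (v k) + blend k (u′ k) (v′ k) ≈⟨ ≡-mod-+ (mix≡blend u v k) (mix≡blend u′ v′ k) ⟨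
    mix u v k + mix u′ v′ k                   ∎)
    where open ≡-mod-Reasoning (suc k)

  mix-*̂ : ∀ u u′ v v′ k → mix (u *̂ u′) (v *̂ v′) k ≡ (mix u v *̂ mix u′ v′) k
  mix-*̂ u u′ v v′ k = ≡-mod⇒%≡ (begin
    _                                         ≈⟨ mix-unreduced k _ _ ⟩
    blend k ((u *̂ u′) k) ((v *̂ v′) k)          ≈⟨ Blendₖ.blend-cong k (%-≡-mod _ (suc k)) (%-≡-mod _ (suc k)) ⟩
    blend k (u k * u′ k) (v k * v′ k)         ≈⟨ Blendₖ.blend-* k (u k) (v k) (u′ k) (v′ k) ⟨
    blend k (u k) (v k) * blend k (u′ k) (v′ k) ≈⟨ ≡-mod-* (mix≡blend u v k) (mix≡blend u′ v′ k) ⟨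
    mix u v k * mix u′ v′ k                   ∎)
    where open ≡-mod-Reasoning (suc k)

  mix-diag : ∀ u k → mix u u k ≡ u k % suc k
  mix-diag u k = ≡-mod⇒%≡ (≡-mod-trans (mix-unreduced k (u k) (u k)) (Blendₖ.blend-diag k (u k)))

  mix≡ˡ-part : ∀ u v k → mix u v k ≡ u k mod part-at k
  mix≡ˡ-part u v k = begin
    mix u v k                     ≈⟨ ≡-mod-∣ (part∣ (split-at k)) (mix≡blend u v k) ⟩
    ε k * u k + ε′ k * v k        ≈⟨ ≡-mod-+ (≡-mod-* (ε-part k) ≡-mod-refl) (≡-mod-* (ε′-part k) ≡-mod-refl) ⟩
    1 * u k + 0 * v k             ≡⟨ trans (+-identityʳ _) (*-identityˡ (u k)) ⟩
    u k                           ∎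
    where open ≡-mod-Reasoning (part-at k)

  mix≡ʳ-cofactor : ∀ u v k → mix u v k ≡ v k mod cofactor-at k
  mix≡ʳ-cofactor u v k = begin
    mix u v k                     ≈⟨ ≡-mod-∣ (cofactor∣ (split-at k)) (mix≡blend u v k) ⟩
    ε k * u k + ε′ k * v k        ≈⟨ ≡-mod-+ (≡-mod-* (ε-cofactor k) ≡-mod-refl) (≡-mod-* (ε′-cofactor k) ≡-mod-refl) ⟩
    0 * u k + 1 * v k             ≡⟨ *-identityˡ (v k) ⟩
    v k                           ∎
    where open ≡-mod-Reasoning (cofactor-at k)

  mix<suc : ∀ u v k → mix u v k < suc k
  mix<suc u v k = m%n<n ((ε k * u k) % suc k + (ε′ k * v k) % suc k) (suc k)

  mix≡ˡ : ValidẐ u → u k ≡ v k mod cofactor-at k → mix u v k ≡ u k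
  mix≡ˡ {u} {k} {v} valid-u u≡v = ≡-mod⇒≡ (mix<suc u v k) (proj₁ valid-u k)
    (≡-mod-CRT-at k (mix≡ˡ-part u v k) (≡-mod-trans (mix≡ʳ-cofactor u v k) (≡-mod-sym u≡v)))

  mix≡ʳ : ValidẐ v → u k ≡ v k mod part-at k → mix u v k ≡ v k
  mix≡ʳ {v} {u} {k} valid-v u≡v = ≡-mod⇒≡ (mix<suc u v k) (proj₁ valid-v k)
    (≡-mod-CRT-at k (≡-mod-trans (mix≡ˡ-part u v k) u≡v) (mix≡ʳ-cofactor u v k))

  valid-mix : ValidẐ u → ValidẐ v → ValidẐ (mix u v)
  valid-mix valid-u valid-v = valid-+̂ (valid-*̂ valid-ε valid-u) (valid-*̂ valid-ε′ valid-v)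

  mixMat : Mat → Mat → Mat
  mixMat A B = mat (mix (a A) (a B)) (mix (b A) (b B)) (mix (c A) (c B)) (mix (d A) (d B))

  valid-mixMat : ∀ {A B} → ValidMat A → ValidMat B → ValidMat (mixMat A B)
  valid-mixMat (a₁ , b₁ , c₁ , d₁) (a₂ , b₂ , c₂ , d₂) =
    valid-mix a₁ a₂ , valid-mix b₁ b₂ , valid-mix c₁ c₂ , valid-mix d₁ d₂

  mix-row·column : ∀ u₁ u₂ u₃ u₄ v₁ v₂ v₃ v₄ k
    → (mix u₁ v₁ *̂ mix u₂ v₂ +̂ mix u₃ v₃ *̂ mix u₄ v₄) k ≡ mix (u₁ *̂ u₂ +̂ u₃ *̂ u₄) (v₁ *̂ v₂ +̂ v₃ *̂ v₄) k
  mix-row·column u₁ u₂ u₃ u₄ v₁ v₂ v₃ v₄ k =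
    trans (cong₂ (λ x y → (x + y) % suc k) (sym (mix-*̂ u₁ u₂ v₁ v₂ k)) (sym (mix-*̂ u₃ u₄ v₃ v₄ k)))
          (sym (mix-+̂ (u₁ *̂ u₂) (u₃ *̂ u₄) (v₁ *̂ v₂) (v₃ *̂ v₄) k))

  mixMat-· : ∀ A B A′ B′ → (mixMat A B · mixMat A′ B′) ≈ mixMat (A · A′) (B · B′)
  mixMat-· A B A′ B′ k =
      mix-row·column (a A) (a A′) (b A) (c A′) (a B) (a B′) (b B) (c B′) k
    , mix-row·column (a A) (b A′) (b A) (d A′) (a B) (b B′) (b B) (d B′) k
    , mix-row·column (c A) (a A′) (d A) (c A′) (c B) (a B′) (d B) (c B′) k
    , mix-row·column (c A) (b A′) (d A) (d A′) (c B) (b B′) (d B) (d B′) k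

  mixMat-cong : ∀ {A A′ B B′} → A ≈ A′ → B ≈ B′ → mixMat A B ≈ mixMat A′ B′
  mixMat-cong {A} {A′} {B} {B′} A≈A′ B≈B′ k = entries (A≈A′ k) (B≈B′ k)
    where
    mixₖ : ℕ → ℕ → ℕ
    mixₖ m n = ((ε k * m) % suc k + (ε′ k * n) % suc k) % suc k
    entries : A ≡[mod-suc k ] A′ → B ≡[mod-suc k ] B′ → mixMat A B ≡[mod-suc k ] mixMat A′ B′
    entries (a₁ , b₁ , c₁ , d₁) (a₂ , b₂ , c₂ , d₂) =
      cong₂ mixₖ a₁ a₂ , cong₂ mixₖ b₁ b₂ , cong₂ mixₖ c₁ c₂ , cong₂ mixₖ d₁ d₂

  mixMat-I₂ : mixMat I₂ I₂ ≈ I₂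
  mixMat-I₂ k = mix-1̂ , mix-diag 0̂ k , mix-diag 0̂ k , mix-1̂
    where
    mix-1̂ : mix 1̂ 1̂ k ≡ 1̂ k
    mix-1̂ = trans (mix-diag 1̂ k) (m%n%n≡m%n 1 (suc k))

  mixMat-inverse : ∀ {A A′ B B′} → (A · A′) ≈ I₂ → (B · B′) ≈ I₂ → (mixMat A B · mixMat A′ B′) ≈ I₂
  mixMat-inverse {A} {A′} {B} {B′} AA′≈I BB′≈I =
    ≈-trans (mixMat-· A B A′ B′) (≈-trans (mixMat-cong AA′≈I BB′≈I) mixMat-I₂)

  mixMat-GL₂ : ∀ {A B} → IsGL₂ A → IsGL₂ B → IsGL₂ (mixMat A B)
  mixMat-GL₂ (valid-A , A′ , valid-A′ , AA′≈I , A′A≈I) (valid-B , B′ , valid-B′ , BB′≈I , B′B≈I) =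
    valid-mixMat valid-A valid-B , mixMat A′ B′ , valid-mixMat valid-A′ valid-B′ ,
    mixMat-inverse AA′≈I BB′≈I , mixMat-inverse A′A≈I B′B≈I

  Ĝ-⊆-by-mixing : (G : Mat → Set) → (∀ A → G A → IsGL₂ A)
    → suc o ∣ suc l → suc o ∣ suc m → part-at l ∣ suc o → cofactor-at m ∣ suc o
    → Ĝ G (suc l) ⊆ G → Ĝ G (suc o) ⊆ Ĝ G (suc m)
  Ĝ-⊆-by-mixing {o} {l} {m} G G⊆GL₂ g∣L g∣M partₗ∣g cofactorₘ∣g Ĝ[L]⊆G A (A∈GL₂ , B , B∈G , B≡A) =
    A∈GL₂ , mixMat A B , C∈G , entrywise mix≡A (proj₁ B∈GL₂) (proj₁ A∈GL₂) B≡A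
    where
    B∈GL₂ : IsGL₂ B
    B∈GL₂ = G⊆GL₂ B B∈G

    agree : ∀ {u v k} → ValidẐ u → ValidẐ v → v o ≡ u o → suc o ∣ suc k → u k ≡ v k mod suc o
    agree valid-u valid-v vₒ≡uₒ g∣k = ≡-mod-trans (valid-compatible valid-u g∣k)
      (≡-mod-trans (≡⇒≡-mod (sym vₒ≡uₒ)) (≡-mod-sym (valid-compatible valid-v g∣k)))

    mix≡A : ∀ {v u} → ValidẐ v → ValidẐ u → v o ≡ u o → mix u v m ≡ u m
    mix≡A {v} valid-v valid-u vₒ≡uₒ = mix≡ˡ {v = v} valid-u (≡-mod-∣ cofactorₘ∣g (agree valid-u valid-v vₒ≡uₒ g∣M))

    B≡mix : ∀ {v u} → ValidẐ v → ValidẐ u → v o ≡ u o → v l ≡ mix u v l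
    B≡mix {v} {u} valid-v valid-u vₒ≡uₒ = sym (mix≡ʳ {u = u} valid-v (≡-mod-∣ partₗ∣g (agree valid-u valid-v vₒ≡uₒ g∣L)))

    C∈G : G (mixMat A B)
    C∈G = Ĝ[L]⊆G (mixMat A B)
      (mixMat-GL₂ A∈GL₂ B∈GL₂ , B , B∈G , entrywise B≡mix (proj₁ B∈GL₂) (proj₁ A∈GL₂) B≡A)

open Idempotents using (part-at; cofactor-at; split-at; Ĝ-⊆-by-mixing)

Ĝ-⊆-coprime : (G : Mat → Set) → (∀ A → G A → IsGL₂ A)
  → ∀ g s t .{{_ : NonZero g}} .{{_ : NonZero s}} .{{_ : NonZero t}} → Coprime t s
  → Ĝ G (g * s) ⊆ G → Ĝ G g ⊆ Ĝ G (g * t)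
Ĝ-⊆-coprime G G⊆GL₂ g@(suc _) s@(suc _) t@(suc _) t⊥s =
  Ĝ-⊆-by-mixing t {l = L-1} {m = M-1} G G⊆GL₂ (m∣m*n s) (m∣m*n t) partₗ∣g cofactorₘ∣g
  where
  L-1 M-1 : ℕ
  L-1 = pred (g * s)
  M-1 = pred (g * t)
  part⊥s : Coprime (part-at t L-1) s
  part⊥s = Coprimality.sym (coprime-∣ʳ (coprime-^ʳ (Coprimality.sym t⊥s) (exponent (split-at t L-1)))
                                       (part∣t^exponent (split-at t L-1)))
  partₗ∣g : part-at t L-1 ∣ g
  partₗ∣g = Coprimality.coprime-divisor part⊥s (subst (part-at t L-1 ∣_) (*-comm g s) (part∣ (split-at t L-1)))
  cofactorₘ∣g : cofactor-at t M-1 ∣ g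
  cofactorₘ∣g = Coprimality.coprime-divisor (cofactor⊥t (split-at t M-1))
    (subst (cofactor-at t M-1 ∣_) (*-comm g t) (cofactor∣ (split-at t M-1)))

gcd-cofactors : ∀ n m .{{_ : NonZero m}} → ∃₂ λ p q → n ≡ gcd n m * p × m ≡ gcd n m * q × Coprime p q
gcd-cofactors n m = n / gcd n m , m / gcd n m
  , sym (m*[n/m]≡n (gcd[m,n]∣m n m)) , sym (m*[n/m]≡n (gcd[m,n]∣n n m)) , Coprimality.coprime-/gcd n m
  where
  instance
    gcd≢0 : NonZero (gcd n m)
    gcd≢0 = gcd-nonZeroʳ n m

gcd*gcd-cofactors : ∀ n m₁ m₂ .{{_ : NonZero m₁}} .{{_ : NonZero m₂}} → Coprime m₁ m₂
  → ∃₂ λ s t → n ≡ (gcd n m₁ * gcd n m₂) * s × m₁ * m₂ ≡ (gcd n m₁ * gcd n m₂) * t × Coprime t s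
gcd*gcd-cofactors n m₁ m₂ m₁⊥m₂
  with a₁ , t₁ , n≡d₁a₁ , m₁≡d₁t₁ , a₁⊥t₁ ← gcd-cofactors n m₁
     | a₂ , t₂ , n≡d₂a₂ , m₂≡d₂t₂ , a₂⊥t₂ ← gcd-cofactors n m₂
     | divides s n≡s*d ← coprime⇒*-∣ (coprime-∣ʳ (coprime-∣ˡ m₁⊥m₂ (gcd[m,n]∣n n m₁)) (gcd[m,n]∣n n m₂))
                                    (gcd[m,n]∣m n m₁) (gcd[m,n]∣m n m₂)
  = s , t₁ * t₂ , n≡d*s , trans (cong₂ _*_ m₁≡d₁t₁ m₂≡d₂t₂) (interchange d₁ t₁ d₂ t₂)
  , Coprimality.sym (coprime-*ʳ (coprime-∣ˡ a₁⊥t₁ (divides d₂ a₁≡d₂s)) (coprime-∣ˡ a₂⊥t₂ (divides d₁ a₂≡d₁s)))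
  where
  d₁ d₂ : ℕ
  d₁ = gcd n m₁
  d₂ = gcd n m₂
  instance
    d₁≢0 : NonZero d₁
    d₁≢0 = gcd-nonZeroʳ n m₁
    d₂≢0 : NonZero d₂
    d₂≢0 = gcd-nonZeroʳ n m₂
  n≡d*s : n ≡ (d₁ * d₂) * s
  n≡d*s = trans n≡s*d (*-comm s (d₁ * d₂))
  a₁≡d₂s : a₁ ≡ d₂ * s
  a₁≡d₂s = *-cancelˡ-≡ a₁ (d₂ * s) d₁ (trans (sym n≡d₁a₁) (trans n≡d*s (*-assoc d₁ d₂ s)))
  a₂≡d₁s : a₂ ≡ d₁ * s
  a₂≡d₁s = *-cancelˡ-≡ a₂ (d₁ * s) d₂ (trans (sym n≡d₂a₂) (trans n≡d*s (xy∙z≈y∙xz d₁ d₂ s)))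

Ĝ-gcd*gcd-⊆ : (G : Mat → Set) → (∀ A → G A → IsGL₂ A) → ∀ L m₁ m₂
  .{{_ : NonZero L}} .{{_ : NonZero m₁}} .{{_ : NonZero m₂}} → Coprime m₁ m₂
  → Ĝ G L ⊆ G → Ĝ G (gcd L m₁ * gcd L m₂) ⊆ Ĝ G (m₁ * m₂)
Ĝ-gcd*gcd-⊆ G G⊆GL₂ L m₁ m₂ m₁⊥m₂ Ĝ[L]⊆G = from-cofactors (gcd*gcd-cofactors L m₁ m₂ m₁⊥m₂)
  where
  g : ℕ
  g = gcd L m₁ * gcd L m₂
  g≢0 : NonZero g
  g≢0 = m*n≢0 (gcd L m₁) (gcd L m₂) {{gcd-nonZeroʳ L m₁}} {{gcd-nonZeroʳ L m₂}}
  from-cofactors : (∃₂ λ s t → L ≡ g * s × m₁ * m₂ ≡ g * t × Coprime t s) → Ĝ G g ⊆ Ĝ G (m₁ * m₂)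
  from-cofactors (s , t , L≡g*s , m≡g*t , t⊥s) =
    subst (λ M → Ĝ G g ⊆ Ĝ G M) (sym m≡g*t)
      (Ĝ-⊆-coprime G G⊆GL₂ g s t
        {{g≢0}} {{*≡⇒nonZeroʳ g (sym L≡g*s)}} {{*≡⇒nonZeroʳ g {{m*n≢0 m₁ m₂}} (sym m≡g*t)}}
        t⊥s (subst (λ N → Ĝ G N ⊆ G) L≡g*s Ĝ[L]⊆G))

lemma3p6 : (G : Mat → Set) → IsOpenSubgroup G
    → (m₁ m₂ : ℕ) → 0 < m₁ → 0 < m₂ → Coprime m₁ m₂
    → (∀ d₁ d₂ → 0 < d₁ → 0 < d₂ → d₁ ∣ m₁ → d₂ ∣ m₂ → ¬ (d₁ ≡ m₁ × d₂ ≡ m₂)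
         → Ĝ G (d₁ * d₂) ⊋ Ĝ G (m₁ * m₂))
    → (L : ℕ) → IsLevel G L → m₁ * m₂ ∣ L
lemma3p6 G G-open m₁ m₂ 0<m₁ 0<m₂ m₁⊥m₂ minimal L (0<L , Ĝ[L]⊆G , _) with m₁ * m₂ ∣? L
... | yes m₁m₂∣L = m₁m₂∣L
... | no m₁m₂∤L = ⊥-elim (proj₂ (minimal d₁ d₂ (>-nonZero⁻¹ d₁) (>-nonZero⁻¹ d₂) d₁∣m₁ d₂∣m₂ d≢m)
                             (Ĝ-gcd*gcd-⊆ G (IsOpenSubgroup.⊆GL₂ G-open) L m₁ m₂ m₁⊥m₂ Ĝ[L]⊆G))
  where
  d₁ d₂ : ℕ
  d₁ = gcd L m₁
  d₂ = gcd L m₂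
  instance
    L≢0 : NonZero L
    L≢0 = >-nonZero 0<L
    m₁≢0 : NonZero m₁
    m₁≢0 = >-nonZero 0<m₁
    m₂≢0 : NonZero m₂
    m₂≢0 = >-nonZero 0<m₂
    d₁≢0 : NonZero d₁
    d₁≢0 = gcd-nonZeroʳ L m₁
    d₂≢0 : NonZero d₂
    d₂≢0 = gcd-nonZeroʳ L m₂
  d₁∣m₁ : d₁ ∣ m₁
  d₁∣m₁ = gcd[m,n]∣n L m₁
  d₂∣m₂ : d₂ ∣ m₂
  d₂∣m₂ = gcd[m,n]∣n L m₂
  d≢m : ¬ (d₁ ≡ m₁ × d₂ ≡ m₂)
  d≢m (d₁≡m₁ , d₂≡m₂) =
    m₁m₂∤L (coprime⇒*-∣ m₁⊥m₂ (subst (_∣ L) d₁≡m₁ (gcd[m,n]∣m L m₁)) (subst (_∣ L) d₂≡m₂ (gcd[m,n]∣m L m₂)))
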